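{- For universes \(\mathcal U,\mathcal V\), the statement \(\text{Tarski's-Theorem}_{\mathcal V,\mathcal V^+\sqcup\mathcal U,\mathcal V}\) implies \(\text{Propositional-Resizing}_{\mathcal U,\mathcal V}\). In particular, \(\text{Tarski's-Theorem}_{\mathcal V,\mathcal V^+,\mathcal V}\) implies \(\text{Propositional-Resizing}_{\mathcal V^+,\mathcal V}\).
   Context: Work in univalent foundations (intensional Martin-Löf type theory with universes, \(\mathcal V^+\) the successor universe, \(\mathcal U\sqcup\mathcal V\) the join, function and propositional extensionality, propositional truncations). A poset is a type with a proposition-valued reflexive, transitive, antisymmetric relation. A \(\mathcal V\)-sup-lattice is a poset in which every family \(I\to X\) with \(I:\mathcal V\) has a supremum. \(\text{Tarski's-Theorem}_{\mathcal V,\mathcal U,\mathcal T}\): every monotone endofunction of a \(\mathcal V\)-sup-lattice whose carrier is in \(\mathcal U\) and whose order takes values in \(\mathcal T\) has a greatest fixed point. \(\text{Propositional-Resizing}_{\mathcal U,\mathcal V}\): every proposition \(P:\mathcal U\) is equivalent to some type in \(\mathcal V\). -}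

module Defs where

open import Level using (Level; _⊔_; Setω) renaming (suc to lsuc)
open import Data.Product using (Σ; _×_; _,_)
open import Relation.Binary.PropositionalEquality using (_≡_)
open import Axiom.Extensionality.Propositional using (Extensionality)
open import Function.Bundles using (_↔_)

isProp : ∀ {ℓ} → Set ℓ → Set ℓ
isProp A = (x y : A) → x ≡ y

FunExt : Setω
FunExt = ∀ {a b} → Extensionality a b

PropExt : Setω
PropExt = ∀ {ℓ} {P Q : Set ℓ} → isProp P → isProp Q → (P → Q) → (Q → P) → P ≡ Q

record PropTrunc : Setω where
  field
    ∥_∥       : ∀ {ℓ} → Set ℓ → Set ℓ
    ∣_∣       : ∀ {ℓ} {A : Set ℓ} → A → ∥ A ∥
    ∥∥-isProp : ∀ {ℓ} {A : Set ℓ} → isProp ∥ A ∥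
    ∥∥-rec    : ∀ {ℓ ℓ'} {A : Set ℓ} {P : Set ℓ'} → isProp P → (A → P) → ∥ A ∥ → P

record Poset (𝓤 𝓣 : Level) : Set (lsuc (𝓤 ⊔ 𝓣)) where
  field
    Carrier      : Set 𝓤
    _⊑_          : Carrier → Carrier → Set 𝓣
    ⊑-prop       : ∀ x y → isProp (x ⊑ y)
    ⊑-refl       : ∀ x → x ⊑ x
    ⊑-trans      : ∀ x y z → x ⊑ y → y ⊑ z → x ⊑ z
    ⊑-antisym    : ∀ x y → x ⊑ y → y ⊑ x → x ≡ y

module _ {𝓤 𝓣 : Level} (P : Poset 𝓤 𝓣) where
  open Poset P

  IsSup : ∀ {𝓥} {I : Set 𝓥} → (I → Carrier) → Carrier → Set (𝓤 ⊔ 𝓣 ⊔ 𝓥)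
  IsSup {I = I} α s = ((i : I) → α i ⊑ s) × ((u : Carrier) → ((i : I) → α i ⊑ u) → s ⊑ u)

  IsSupLattice : (𝓥 : Level) → Set (𝓤 ⊔ 𝓣 ⊔ lsuc 𝓥)
  IsSupLattice 𝓥 = (I : Set 𝓥) (α : I → Carrier) → Σ Carrier (IsSup α)

  Monotone : (Carrier → Carrier) → Set (𝓤 ⊔ 𝓣)
  Monotone f = ∀ x y → x ⊑ y → f x ⊑ f y

  IsGreatestFixedPoint : (Carrier → Carrier) → Carrier → Set (𝓤 ⊔ 𝓣)
  IsGreatestFixedPoint f x = (f x ≡ x) × ((y : Carrier) → f y ≡ y → y ⊑ x)

  HasGreatestFixedPoint : (Carrier → Carrier) → Set (𝓤 ⊔ 𝓣)
  HasGreatestFixedPoint f = Σ Carrier (IsGreatestFixedPoint f)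

Tarski's-Theorem : (𝓥 𝓤 𝓣 : Level) → Set (lsuc (𝓥 ⊔ 𝓤 ⊔ 𝓣))
Tarski's-Theorem 𝓥 𝓤 𝓣 =
  (L : Poset 𝓤 𝓣) → IsSupLattice L 𝓥 →
  (f : Poset.Carrier L → Poset.Carrier L) → Monotone L f → HasGreatestFixedPoint L f

Propositional-Resizing : (𝓤 𝓥 : Level) → Set (lsuc (𝓤 ⊔ 𝓥))
Propositional-Resizing 𝓤 𝓥 = (P : Set 𝓤) → isProp P → Σ (Set 𝓥) (λ Q → P ↔ Q)

{-# OPTIONS --safe #-}
-- The 𝓥-small propositions implying a fixed proposition P, ordered by implication, form a
-- 𝓥-sup-lattice (suprema are truncated unions), but its carrier lives in 𝓥⁺ ⊔ 𝓤. The
-- greatest fixed point of the identity map is a greatest element, and since ⊤ implies P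
-- whenever P holds, that greatest element is a 𝓥-small proposition equivalent to P.
module Submission where

open import Defs
open import Level using (Level; _⊔_; Lift) renaming (suc to lsuc)
open import Data.Product using (_×_; Σ; _,_; proj₁; proj₂)
open import Data.Product.Properties using (×-≡,≡→≡)
open import Data.Unit using (⊤)
open import Function.Base using (id)
open import Function.Bundles using (_↔_; mk↔ₛ′)
open import Relation.Binary.PropositionalEquality using (_≡_; refl; cong)
open import Axiom.UniquenessOfIdentityProofs using (UIP; module Constant⇒UIP)

private
  variable
    a b : Level
    A : Set a

isProp⇒UIP : isProp A → UIP A
isProp⇒UIP {A = A} A-prop =
  Constant⇒UIP.≡-irrelevant {A = A} (λ {x} {y} _ → A-prop x y) (λ _ _ → refl)

isProp-isProp : FunExt → isProp (isProp A)
isProp-isProp fe h k = fe λ x → fe λ y → isProp⇒UIP h (h x y) (k x y)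

isProp-→ : FunExt → {B : Set b} → isProp B → isProp (A → B)
isProp-→ fe B-prop f g = fe λ x → B-prop (f x) (g x)

isProp-× : {B : Set b} → isProp A → isProp B → isProp (A × B)
isProp-× A-prop B-prop (x , y) (x′ , y′) = ×-≡,≡→≡ (A-prop x x′ , B-prop y y′)

Σ-≡-from-proj₁ : {B : A → Set b} → (∀ x → isProp (B x)) →
                 {u v : Σ A B} → proj₁ u ≡ proj₁ v → u ≡ v
Σ-≡-from-proj₁ B-prop {x , y} {.x , y′} refl = cong (x ,_) (B-prop x y y′)

module _ {𝓤 𝓣 : Level} (L : Poset 𝓤 𝓣) where
  open Poset L

  greatestFixedPoint-id-isGreatest : ∀ {t} → IsGreatestFixedPoint L id t → ∀ x → x ⊑ t
  greatestFixedPoint-id-isGreatest (_ , greatest) x = greatest x refl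

Tarski⇒greatest : ∀ {𝓥 𝓤 𝓣} → Tarski's-Theorem 𝓥 𝓤 𝓣 →
                  (L : Poset 𝓤 𝓣) → IsSupLattice L 𝓥 →
                  Σ (Poset.Carrier L) (λ t → ∀ x → Poset._⊑_ L x t)
Tarski⇒greatest tarski L L-sup with tarski L L-sup id (λ _ _ x⊑y → x⊑y)
... | t , t-gfp = t , greatestFixedPoint-id-isGreatest L t-gfp

module SmallSubpropositions (fe : FunExt) (pe : PropExt) (pt : PropTrunc)
  {𝓤 : Level} (𝓥 : Level) (P : Set 𝓤) (P-prop : isProp P) where
  open PropTrunc pt

  Subproposition : Set (lsuc 𝓥 ⊔ 𝓤)
  Subproposition = Σ (Set 𝓥) (λ Q → isProp Q × (Q → P))

  poset : Poset (lsuc 𝓥 ⊔ 𝓤) 𝓥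
  poset = record
    { Carrier   = Subproposition
    ; _⊑_       = λ (Q , _) (R , _) → Q → R
    ; ⊑-prop    = λ _ (_ , R-prop , _) → isProp-→ fe R-prop
    ; ⊑-refl    = λ _ → id
    ; ⊑-trans   = λ _ _ _ Q→R R→S q → R→S (Q→R q)
    ; ⊑-antisym = λ (_ , Q-prop , _) (_ , R-prop , _) Q→R R→Q →
        Σ-≡-from-proj₁ (λ _ → isProp-× (isProp-isProp fe) (isProp-→ fe P-prop))
                       (pe Q-prop R-prop Q→R R→Q)
    }

  isSupLattice : IsSupLattice poset 𝓥
  isSupLattice I α =
      ( ∥ Σ I (λ i → proj₁ (α i)) ∥
      , ∥∥-isProp
      , ∥∥-rec P-prop (λ (i , q) → proj₂ (proj₂ (α i)) q) )
    , (λ i q → ∣ i , q ∣)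
    , (λ (_ , R-prop , _) bound → ∥∥-rec R-prop (λ (i , q) → bound i q))

  greatest↔P : (t : Subproposition) → (∀ x → Poset._⊑_ poset x t) → P ↔ proj₁ t
  greatest↔P (T , T-prop , T→P) greatest =
    mk↔ₛ′ P→T T→P (λ _ → T-prop _ _) (λ _ → P-prop _ _)
    where
    P→T : P → T
    P→T p = greatest (Lift 𝓥 ⊤ , (λ _ _ → refl) , (λ _ → p)) _

  resize : Tarski's-Theorem 𝓥 (lsuc 𝓥 ⊔ 𝓤) 𝓥 → Σ (Set 𝓥) (P ↔_)
  resize tarski with Tarski⇒greatest tarski poset isSupLattice
  ... | t , t-greatest = proj₁ t , greatest↔P t t-greatest

Tarski⇒Propositional-Resizing : FunExt → PropExt → PropTrunc → (𝓤 𝓥 : Level) →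
                                Tarski's-Theorem 𝓥 (lsuc 𝓥 ⊔ 𝓤) 𝓥 → Propositional-Resizing 𝓤 𝓥
Tarski⇒Propositional-Resizing fe pe pt 𝓤 𝓥 tarski P P-prop =
  SmallSubpropositions.resize fe pe pt 𝓥 P P-prop tarski

theorem5p6 : FunExt → PropExt → PropTrunc → (𝓤 𝓥 : Level) →
    (Tarski's-Theorem 𝓥 (lsuc 𝓥 ⊔ 𝓤) 𝓥 → Propositional-Resizing 𝓤 𝓥)
    × (Tarski's-Theorem 𝓥 (lsuc 𝓥) 𝓥 → Propositional-Resizing (lsuc 𝓥) 𝓥)
-- The second part is the first at 𝓤 = 𝓥⁺, since 𝓥⁺ ⊔ 𝓥⁺ reduces to 𝓥⁺.
theorem5p6 fe pe pt 𝓤 𝓥 =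
    Tarski⇒Propositional-Resizing fe pe pt 𝓤 𝓥
  , Tarski⇒Propositional-Resizing fe pe pt (lsuc 𝓥) 𝓥
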